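{- Let $a$ and $b$ be positive integers. Then $S_1(a,b)\geq S_1(a-1,b)+S_1(a,b-1)+1$.
   Context: For a positive integer $n$, write $[n]=\{1,\dots,n\}$. A skew Bollob\'{a}s system is a finite collection $\mathcal{P}=\{(A_i,B_i):1\leq i\leq m\}$ of pairs of subsets of $[n]$ (for some positive integer $n$) such that $A_i\cap B_i=\emptyset$ for all $i\in[m]$ and $A_i\cap B_j\neq\emptyset$ for all $1\leq i<j\leq m$. For non-negative integers $a,b$, define $S_1(a,b)$ to be the maximum of $\left|\bigcup_{i=1}^m A_i\right|$ over all skew Bollob\'{a}s systems $\{(A_i,B_i):1\leq i\leq m\}$ (over all $n$ and $m$) satisfying $|A_i|\leq a$ and $|B_i|\leq b$ for all $i\in[m]$. -}

module Defs where

open import Data.Nat using (ℕ; _≤_)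
open import Data.Fin using (Fin; _<_)
open import Data.Fin.Subset using (Subset; _∩_; ⋃; ∣_∣; Empty; Nonempty)
open import Data.List using (tabulate)
open import Data.Product using (Σ; ∃; _×_)
open import Relation.Binary.PropositionalEquality using (_≡_)

-- A skew Bollobás system of m pairs of subsets of [n] (= Fin n).
-- Index i : Fin m stands for i+1 ∈ [m]; the order on Fin m matches.
record SkewBollobas (n m : ℕ) : Set where
  field
    A     : Fin m → Subset n
    B     : Fin m → Subset n
    disj  : ∀ i → Empty (A i ∩ B i)
    cross : ∀ i j → i < j → Nonempty (A i ∩ B j)

open SkewBollobas public

Bounded : ∀ {n m} → ℕ → ℕ → SkewBollobas n m → Set
Bounded a b P = ∀ i → ∣ A P i ∣ ≤ a × ∣ B P i ∣ ≤ b

unionSize : ∀ {n m} → SkewBollobas n m → ℕ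
unionSize {m = m} P = ∣ ⋃ (tabulate {n = m} (A P)) ∣

Attained : ℕ → ℕ → ℕ → Set
Attained a b k =
  ∃ λ n → ∃ λ m → (1 ≤ n) × (1 ≤ m) ×
    Σ (SkewBollobas n m) λ P → Bounded a b P × unionSize P ≡ k

IsS₁ : ℕ → ℕ → ℕ → Set
IsS₁ a b s = Attained a b s × (∀ k → Attained a b k → k ≤ s)

-- Take systems P and Q attaining S₁(a-1, b) and S₁(a, b-1), on disjoint ground
-- sets, and add one new point x₀. List the pairs of P first, each with x₀ added
-- to its A-set, then the pairs of Q, each with x₀ added to its B-set. Pairs
-- within P or within Q still satisfy the skew conditions, and any pair of P
-- against a later pair of Q meets in x₀. The result satisfies the bounds (a, b)
-- and its A-sets cover x₀ together with both old unions.
module Submission where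

open import Defs
open import Data.Nat using (ℕ; zero; suc; _≤_; _+_; _∸_; s≤s; z≤n; s<s⁻¹)
  renaming (_<_ to _<ℕ_)
open import Data.Nat.Properties using (+-comm; +-cancelˡ-<)
open import Data.Fin using (Fin; _<_; toℕ; splitAt; join; _↑ˡ_; _↑ʳ_)
  renaming (zero to fzero; suc to fsuc)
open import Data.Fin.Properties
  using (toℕ-↑ˡ; toℕ-↑ʳ; join-splitAt; splitAt-↑ˡ; splitAt-↑ʳ)
open import Data.Fin.Subset
  using (Subset; inside; outside; ⊥; _∈_; _∩_; _∪_; ⋃; ∣_∣; Empty; Nonempty)
open import Data.Fin.Subset.Properties
  using (∉⊥; drop-∷-Empty; x∈p∩q⁻; ∣⊥∣≡0; ∪-assoc; ∪-identityˡ; ∪-identityʳ; ∪-idem)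
open import Data.Vec using ([]; _∷_; _++_; here; there)
open import Data.Vec.Properties using (zipWith-++)
open import Data.List using (tabulate; map) renaming (_∷_ to _∷ᴸ_; [] to []ᴸ)
open import Data.List.Properties using (tabulate-cong; map-tabulate)
open import Data.Product using (_,_; proj₁; proj₂)
open import Data.Sum using (_⊎_; inj₁; inj₂; [_,_]′)
open import Data.Empty using (⊥-elim)
open import Function using (_∘_)
open import Relation.Nullary using (¬_)
open import Relation.Binary.PropositionalEquality
  using (_≡_; refl; sym; trans; cong; cong₂; subst; subst₂; module ≡-Reasoning)

private
  variable
    k m n m₁ m₂ n₁ n₂ a b : ℕ

↑ˡ-cancel-< : ∀ n {i j : Fin m} → i ↑ˡ n < j ↑ˡ n → i < j
↑ˡ-cancel-< n {i} {j} = subst₂ _<ℕ_ (toℕ-↑ˡ i n) (toℕ-↑ˡ j n)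

↑ʳ-cancel-< : ∀ m {i j : Fin n} → m ↑ʳ i < m ↑ʳ j → i < j
↑ʳ-cancel-< m {i} {j} lt =
  +-cancelˡ-< m (toℕ i) (toℕ j) (subst₂ _<ℕ_ (toℕ-↑ʳ m i) (toℕ-↑ʳ m j) lt)

↑ʳ≮↑ˡ : ∀ m (i : Fin n) (j : Fin m) → ¬ (m ↑ʳ i < j ↑ˡ n)
↑ʳ≮↑ˡ (suc m) i fzero     ()
↑ʳ≮↑ˡ (suc m) i (fsuc j) lt = ↑ʳ≮↑ˡ m i j (s<s⁻¹ lt)

∣p++q∣≡∣p∣+∣q∣ : (p : Subset m) (q : Subset n) → ∣ p ++ q ∣ ≡ ∣ p ∣ + ∣ q ∣
∣p++q∣≡∣p∣+∣q∣ []            q = refl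
∣p++q∣≡∣p∣+∣q∣ (inside  ∷ p) q = cong suc (∣p++q∣≡∣p∣+∣q∣ p q)
∣p++q∣≡∣p∣+∣q∣ (outside ∷ p) q = ∣p++q∣≡∣p∣+∣q∣ p q

∣p++⊥∣≡∣p∣ : ∀ n (p : Subset m) → ∣ p ++ ⊥ {n} ∣ ≡ ∣ p ∣
∣p++⊥∣≡∣p∣ n p = begin
  ∣ p ++ ⊥ ∣          ≡⟨ ∣p++q∣≡∣p∣+∣q∣ p ⊥ ⟩
  ∣ p ∣ + ∣ ⊥ {n} ∣   ≡⟨ cong (∣ p ∣ +_) (∣⊥∣≡0 n) ⟩
  ∣ p ∣ + 0           ≡⟨ +-comm ∣ p ∣ 0 ⟩
  ∣ p ∣               ∎
  where open ≡-Reasoning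

∣⊥++p∣≡∣p∣ : ∀ m (p : Subset n) → ∣ ⊥ {m} ++ p ∣ ≡ ∣ p ∣
∣⊥++p∣≡∣p∣ m p = trans (∣p++q∣≡∣p∣+∣q∣ (⊥ {m}) p) (cong (_+ ∣ p ∣) (∣⊥∣≡0 m))

++-∩ : (p p′ : Subset m) (q q′ : Subset n) →
       (p ++ q) ∩ (p′ ++ q′) ≡ (p ∩ p′) ++ (q ∩ q′)
++-∩ p p′ q q′ = zipWith-++ _ p q p′ q′

++-∪ : (p p′ : Subset m) (q q′ : Subset n) →
       (p ++ q) ∪ (p′ ++ q′) ≡ (p ∪ p′) ++ (q ∪ q′)
++-∪ p p′ q q′ = zipWith-++ _ p q p′ q′

++⊥-∪ : (p q : Subset m) → (p ∪ q) ++ ⊥ {n} ≡ (p ++ ⊥) ∪ (q ++ ⊥)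
++⊥-∪ p q = trans (cong ((p ∪ q) ++_) (sym (∪-idem ⊥))) (sym (++-∪ p q ⊥ ⊥))

⊥++-∪ : (p q : Subset n) → ⊥ {m} ++ (p ∪ q) ≡ (⊥ ++ p) ∪ (⊥ ++ q)
⊥++-∪ p q = trans (cong (_++ (p ∪ q)) (sym (∪-idem ⊥))) (sym (++-∪ ⊥ ⊥ p q))

∈-++⁺ˡ : {x : Fin m} {p : Subset m} {q : Subset n} → x ∈ p → x ↑ˡ n ∈ p ++ q
∈-++⁺ˡ here        = here
∈-++⁺ˡ (there x∈p) = there (∈-++⁺ˡ x∈p)

∈-++⁺ʳ : {x : Fin n} (p : Subset m) {q : Subset n} → x ∈ q → m ↑ʳ x ∈ p ++ q
∈-++⁺ʳ []      x∈q = x∈q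
∈-++⁺ʳ (_ ∷ p) x∈q = there (∈-++⁺ʳ p x∈q)

Nonempty-++ˡ : {p : Subset m} {q : Subset n} → Nonempty p → Nonempty (p ++ q)
Nonempty-++ˡ (x , x∈p) = _ , ∈-++⁺ˡ x∈p

Nonempty-++ʳ : (p : Subset m) {q : Subset n} → Nonempty q → Nonempty (p ++ q)
Nonempty-++ʳ p (x , x∈q) = _ , ∈-++⁺ʳ p x∈q

Nonempty-∷ : ∀ s {p : Subset n} → Nonempty p → Nonempty (s ∷ p)
Nonempty-∷ s (x , x∈p) = fsuc x , there x∈p

Empty-++ : {p : Subset m} {q : Subset n} → Empty p → Empty q → Empty (p ++ q)
Empty-++ {p = []}    _  ∅q x∈q                  = ∅q x∈q
Empty-++ {p = _ ∷ p} ∅p ∅q (fzero  , here)      = ∅p (fzero , here)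
Empty-++ {p = _ ∷ p} ∅p ∅q (fsuc x , there x∈) = Empty-++ (drop-∷-Empty ∅p) ∅q (x , x∈)

Empty-∷ : {p : Subset n} → Empty p → Empty (outside ∷ p)
Empty-∷ ∅p (fsuc x , there x∈p) = ∅p (x , x∈p)

Empty-⊥∩ : (q : Subset n) → Empty (⊥ ∩ q)
Empty-⊥∩ q (x , x∈⊥∩q) = ∉⊥ (proj₁ (x∈p∩q⁻ ⊥ q x∈⊥∩q))

⋃-tabulate-+ : ∀ m n (f : Fin (m + n) → Subset k) →
  ⋃ (tabulate f) ≡ ⋃ (tabulate (f ∘ (_↑ˡ n))) ∪ ⋃ (tabulate (f ∘ (m ↑ʳ_)))
⋃-tabulate-+ zero    n f = sym (∪-identityˡ _)
⋃-tabulate-+ (suc m) n f = trans (cong (f fzero ∪_) (⋃-tabulate-+ m n (f ∘ fsuc)))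
                                   (sym (∪-assoc (f fzero) _ _))

⋃-map-∷ : (f : Subset m → Subset n) → (∀ p q → f (p ∪ q) ≡ f p ∪ f q) →
          ∀ p ps → ⋃ (map f (p ∷ᴸ ps)) ≡ f (⋃ (p ∷ᴸ ps))
⋃-map-∷ f f-∪ p []ᴸ = trans (∪-identityʳ (f p)) (cong f (sym (∪-identityʳ p)))
⋃-map-∷ f f-∪ p (q ∷ᴸ qs) =
  trans (cong (f p ∪_) (⋃-map-∷ f f-∪ q qs)) (sym (f-∪ p (⋃ (q ∷ᴸ qs))))

module _ (P : SkewBollobas n m₁) (Q : SkewBollobas n m₂)
         (meet : ∀ i j → Nonempty (A P i ∩ B Q j)) where

  private
    A⊎ B⊎ : Fin m₁ ⊎ Fin m₂ → Subset n
    A⊎ = [ A P , A Q ]′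
    B⊎ = [ B P , B Q ]′

    disj⊎ : ∀ s → Empty (A⊎ s ∩ B⊎ s)
    disj⊎ (inj₁ i) = disj P i
    disj⊎ (inj₂ j) = disj Q j

    cross⊎ : ∀ s t → join m₁ m₂ s < join m₁ m₂ t → Nonempty (A⊎ s ∩ B⊎ t)
    cross⊎ (inj₁ i) (inj₁ j) lt = cross P i j (↑ˡ-cancel-< m₂ lt)
    cross⊎ (inj₁ i) (inj₂ j) _  = meet i j
    cross⊎ (inj₂ i) (inj₁ j) lt = ⊥-elim (↑ʳ≮↑ˡ m₁ i j lt)
    cross⊎ (inj₂ i) (inj₂ j) lt = cross Q i j (↑ʳ-cancel-< m₁ lt)

  concat : SkewBollobas n (m₁ + m₂)
  concat = record
    { A     = A⊎ ∘ splitAt m₁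
    ; B     = B⊎ ∘ splitAt m₁
    ; disj  = disj⊎ ∘ splitAt m₁
    ; cross = λ i j i<j → cross⊎ (splitAt m₁ i) (splitAt m₁ j)
        (subst₂ _<_ (sym (join-splitAt m₁ m₂ i)) (sym (join-splitAt m₁ m₂ j)) i<j)
    }

  ⋃-concat : ⋃ (tabulate (A concat)) ≡ ⋃ (tabulate (A P)) ∪ ⋃ (tabulate (A Q))
  ⋃-concat = trans (⋃-tabulate-+ m₁ m₂ (A concat))
    (cong₂ (λ xs ys → ⋃ xs ∪ ⋃ ys)
      (tabulate-cong (cong A⊎ ∘ λ i → splitAt-↑ˡ m₁ i m₂))
      (tabulate-cong (cong A⊎ ∘ splitAt-↑ʳ m₁ m₂)))

  bounded-concat : Bounded a b P → Bounded a b Q → Bounded a b concat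
  bounded-concat bP bQ k with splitAt m₁ k
  ... | inj₁ i = bP i
  ... | inj₂ j = bQ j

-- The new point x₀ is index 0 of Fin (suc (n₁ + n₂)).

module _ (P : SkewBollobas n₁ m) where

  liftWithPointInA : SkewBollobas (suc (n₁ + n₂)) m
  liftWithPointInA = record
    { A     = λ i → inside  ∷ (A P i ++ ⊥)
    ; B     = λ i → outside ∷ (B P i ++ ⊥)
    ; disj  = λ i → Empty-∷ (subst Empty (sym (++-∩ (A P i) (B P i) ⊥ ⊥))
                                   (Empty-++ (disj P i) (Empty-⊥∩ ⊥)))
    ; cross = λ i j i<j → Nonempty-∷ outside
                (subst Nonempty (sym (++-∩ (A P i) (B P j) ⊥ ⊥))
                       (Nonempty-++ˡ (cross P i j i<j)))
    }

  bounded-liftWithPointInA : Bounded a b P → Bounded (suc a) b (liftWithPointInA {n₂ = n₂})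
  bounded-liftWithPointInA {n₂ = n₂} bP i =
    s≤s (subst (_≤ _) (sym (∣p++⊥∣≡∣p∣ n₂ (A P i))) (proj₁ (bP i))) ,
    subst (_≤ _) (sym (∣p++⊥∣≡∣p∣ n₂ (B P i))) (proj₂ (bP i))

module _ (Q : SkewBollobas n₂ m) where

  liftWithPointInB : SkewBollobas (suc (n₁ + n₂)) m
  liftWithPointInB = record
    { A     = λ i → outside ∷ (⊥ ++ A Q i)
    ; B     = λ i → inside  ∷ (⊥ ++ B Q i)
    ; disj  = λ i → Empty-∷ (subst Empty (sym (++-∩ ⊥ ⊥ (A Q i) (B Q i)))
                                   (Empty-++ (Empty-⊥∩ ⊥) (disj Q i)))
    ; cross = λ i j i<j → Nonempty-∷ outside
                (subst Nonempty (sym (++-∩ ⊥ ⊥ (A Q i) (B Q j)))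
                       (Nonempty-++ʳ (⊥ ∩ ⊥) (cross Q i j i<j)))
    }

  bounded-liftWithPointInB : Bounded a b Q → Bounded a (suc b) (liftWithPointInB {n₁ = n₁})
  bounded-liftWithPointInB {n₁ = n₁} bQ i =
    subst (_≤ _) (sym (∣⊥++p∣≡∣p∣ n₁ (A Q i))) (proj₁ (bQ i)) ,
    s≤s (subst (_≤ _) (sym (∣⊥++p∣≡∣p∣ n₁ (B Q i))) (proj₂ (bQ i)))

⋃-liftWithPointInA : (P : SkewBollobas n₁ (suc m)) →
  ⋃ (tabulate (A (liftWithPointInA P {n₂ = n₂}))) ≡ inside ∷ (⋃ (tabulate (A P)) ++ ⊥)
⋃-liftWithPointInA {n₂ = n₂} P = begin
  ⋃ (tabulate (f ∘ A P))     ≡⟨ cong ⋃ (map-tabulate (A P) f) ⟨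
  ⋃ (map f (tabulate (A P))) ≡⟨ ⋃-map-∷ f (λ p q → cong (inside ∷_) (++⊥-∪ p q))
                                   (A P fzero) (tabulate (A P ∘ fsuc)) ⟩
  f (⋃ (tabulate (A P)))     ∎
  where
  open ≡-Reasoning
  f : Subset n₁ → Subset (suc (n₁ + n₂))
  f p = inside ∷ (p ++ ⊥)

⋃-liftWithPointInB : (Q : SkewBollobas n₂ (suc m)) →
  ⋃ (tabulate (A (liftWithPointInB Q {n₁ = n₁}))) ≡ outside ∷ (⊥ ++ ⋃ (tabulate (A Q)))
⋃-liftWithPointInB {n₁ = n₁} Q = begin
  ⋃ (tabulate (f ∘ A Q))     ≡⟨ cong ⋃ (map-tabulate (A Q) f) ⟨
  ⋃ (map f (tabulate (A Q))) ≡⟨ ⋃-map-∷ f (λ p q → cong (outside ∷_) (⊥++-∪ p q))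
                                   (A Q fzero) (tabulate (A Q ∘ fsuc)) ⟩
  f (⋃ (tabulate (A Q)))     ∎
  where
  open ≡-Reasoning
  f : Subset n₂ → Subset (suc (n₁ + n₂))
  f q = outside ∷ (⊥ ++ q)

module _ (P : SkewBollobas n₁ m₁) (Q : SkewBollobas n₂ m₂) where

  private
    P′ = liftWithPointInA P {n₂ = n₂}
    Q′ = liftWithPointInB Q {n₁ = n₁}

    x₀∈A∩B : ∀ i j → Nonempty (A P′ i ∩ B Q′ j)
    x₀∈A∩B _ _ = fzero , here

  glue : SkewBollobas (suc (n₁ + n₂)) (m₁ + m₂)
  glue = concat P′ Q′ x₀∈A∩B

  ⋃-glue : ⋃ (tabulate (A glue)) ≡ ⋃ (tabulate (A P′)) ∪ ⋃ (tabulate (A Q′))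
  ⋃-glue = ⋃-concat P′ Q′ x₀∈A∩B

  bounded-glue : Bounded a (suc b) P → Bounded (suc a) b Q → Bounded (suc a) (suc b) glue
  bounded-glue bP bQ = bounded-concat P′ Q′ x₀∈A∩B
    (bounded-liftWithPointInA P bP) (bounded-liftWithPointInB Q {n₁ = n₁} bQ)

unionSize-glue : (P : SkewBollobas n₁ (suc m₁)) (Q : SkewBollobas n₂ (suc m₂)) →
  unionSize (glue P Q) ≡ suc (unionSize P + unionSize Q)
unionSize-glue P Q = begin
  ∣ ⋃ (tabulate (A (glue P Q))) ∣
    ≡⟨ cong ∣_∣ (⋃-glue P Q) ⟩
  ∣ ⋃ (tabulate (A (liftWithPointInA P))) ∪ ⋃ (tabulate (A (liftWithPointInB Q))) ∣
    ≡⟨ cong₂ (λ p q → ∣ p ∪ q ∣) (⋃-liftWithPointInA P) (⋃-liftWithPointInB Q) ⟩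
  ∣ inside ∷ ((U₁ ++ ⊥) ∪ (⊥ ++ U₂)) ∣
    ≡⟨ cong (∣_∣ ∘ (inside ∷_)) (++-∪ U₁ ⊥ ⊥ U₂) ⟩
  suc ∣ (U₁ ∪ ⊥) ++ (⊥ ∪ U₂) ∣
    ≡⟨ cong₂ (λ p q → suc ∣ p ++ q ∣) (∪-identityʳ U₁) (∪-identityˡ U₂) ⟩
  suc ∣ U₁ ++ U₂ ∣
    ≡⟨ cong suc (∣p++q∣≡∣p∣+∣q∣ U₁ U₂) ⟩
  suc (∣ U₁ ∣ + ∣ U₂ ∣) ∎
  where
  open ≡-Reasoning
  U₁ = ⋃ (tabulate (A P))
  U₂ = ⋃ (tabulate (A Q))

attained-glue : ∀ {s₁ s₂} → Attained a (suc b) s₁ → Attained (suc a) b s₂ →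
                Attained (suc a) (suc b) (suc (s₁ + s₂))
attained-glue (n₁ , suc m₁ , _ , _ , P , bP , refl) (n₂ , suc m₂ , _ , _ , Q , bQ , refl) =
  suc (n₁ + n₂) , suc m₁ + suc m₂ , s≤s z≤n , s≤s z≤n , glue P Q ,
  bounded-glue P Q bP bQ ,
  unionSize-glue P Q

lemma2p2 : (a b : ℕ) → 1 ≤ a → 1 ≤ b →
    (s s₁ s₂ : ℕ) → IsS₁ a b s → IsS₁ (a ∸ 1) b s₁ → IsS₁ a (b ∸ 1) s₂ →
    s₁ + s₂ + 1 ≤ s
lemma2p2 (suc a) (suc b) _ _ s s₁ s₂ (_ , maximal) (attained₁ , _) (attained₂ , _) =
  subst (_≤ s) (+-comm 1 (s₁ + s₂))
        (maximal _ (attained-glue attained₁ attained₂))
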